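{- For every integer $n \geq 0$, \[ B_n \setminus \{0\} = \coprod_{j=0}^{\lfloor n/2\rfloor} 2^j S_{n-2j}, \] where the union is disjoint and $2^j S$ denotes $\{2^j s : s \in S\}$.
   Context: For $n \geq 0$, $B_n = \left\{ \sum_{j=0}^n v_j (1+i)^j : v_j \in \{0,\pm 1,\pm i\}\right\} \subset \mathbb{Z}[i]$. For $n\geq 0$ define $w_n = 2^{k+1}+2^k$ if $n=2k$ and $w_n = 2^{k+2}$ if $n=2k+1$. For $n\geq 0$ define \[ S_n = \{ x+yi \in \mathbb{Z}[i]\setminus\{0\} : 2 \nmid \gcd(x,y);\ |x|,|y| \leq w_n - 2;\ |x|+|y| \leq w_{n+1}-3 \}. \] -}

module Defs where

open import Data.Nat as ℕ using (ℕ; zero; suc; _∸_)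
open import Data.Nat.DivMod using (_/_; _%_)
open import Data.Integer as ℤ using (ℤ; +_; ∣_∣)
open import Data.Integer.GCD using (gcd)
open import Data.Integer.Divisibility using (_∣_)
open import Data.Fin using (Fin; toℕ)
open import Data.Product using (_×_; _,_; Σ; ∃; ∃-syntax)
open import Relation.Binary.PropositionalEquality using (_≡_)
open import Relation.Nullary using (¬_)

record ℤ[i] : Set where
  constructor _+_i
  field
    re : ℤ
    im : ℤ
open ℤ[i] public

0ᵍ : ℤ[i]
0ᵍ = (+ 0) + (+ 0) i

_+ᵍ_ : ℤ[i] → ℤ[i] → ℤ[i]
(a + b i) +ᵍ (c + d i) = (a ℤ.+ c) + (b ℤ.+ d) i

_*ᵍ_ : ℤ[i] → ℤ[i] → ℤ[i]
(a + b i) *ᵍ (c + d i) = (a ℤ.* c ℤ.- b ℤ.* d) + (a ℤ.* d ℤ.+ b ℤ.* c) i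

_^ᵍ_ : ℤ[i] → ℕ → ℤ[i]
z ^ᵍ zero  = (+ 1) + (+ 0) i
z ^ᵍ suc n = z *ᵍ (z ^ᵍ n)

ω : ℤ[i]
ω = (+ 1) + (+ 1) i

data Digit : Set where
  d0 d1 d-1 di d-i : Digit

digit : Digit → ℤ[i]
digit d0  = (+ 0) + (+ 0) i
digit d1  = (+ 1) + (+ 0) i
digit d-1 = ℤ.-[1+ 0 ] + (+ 0) i
digit di  = (+ 0) + (+ 1) i
digit d-i = (+ 0) + ℤ.-[1+ 0 ] i

sumᵍ : (m : ℕ) → (Fin m → ℤ[i]) → ℤ[i]
sumᵍ zero    f = 0ᵍ
sumᵍ (suc m) f = f Fin.zero +ᵍ sumᵍ m (λ j → f (Fin.suc j))
  where import Data.Fin as Fin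

InB : ℕ → ℤ[i] → Set
InB n z = Σ (Fin (suc n) → Digit) λ v →
  z ≡ sumᵍ (suc n) (λ j → digit (v j) *ᵍ (ω ^ᵍ toℕ j))

w : ℕ → ℕ
w n with n % 2
... | zero  = 2 ℕ.^ (n / 2 ℕ.+ 1) ℕ.+ 2 ℕ.^ (n / 2)
... | suc _ = 2 ℕ.^ (n / 2 ℕ.+ 2)

InS : ℕ → ℤ[i] → Set
InS n z =
  ¬ (z ≡ 0ᵍ)
  × ¬ (+ 2 ∣ gcd (re z) (im z))
  × (+ ∣ re z ∣ ℤ.≤ + w n ℤ.- + 2)
  × (+ ∣ im z ∣ ℤ.≤ + w n ℤ.- + 2)
  × (+ ∣ re z ∣ ℤ.+ + ∣ im z ∣ ℤ.≤ + w (suc n) ℤ.- + 3)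

scale2 : ℕ → ℤ[i] → ℤ[i]
scale2 j s = ((+ (2 ℕ.^ j)) + (+ 0) i) *ᵍ s

-- Every z ∈ B_n has a Horner expansion z = d₀ + (1+i)(d₁ + (1+i)(⋯)) with digits in {0, ±1, ±i}.
-- Since (1+i)² = 2i, an even z forces d₀ = d₁ = 0 and z = 2·(i c) with i c ∈ B_(n-2); dividing
-- out 2 as long as possible ends in a primitive element of some B_(n-2j), and the box bounds
-- defining S_m hold on all of B_m by induction, two digits at a time, using w_(m+2) = 2 w_m.
-- Conversely, after the symmetries z ↦ i z and z ↦ z̄ an element of S_(m+1) has non-negative
-- coordinates and odd real part; subtracting a digit d ∈ {0, ±i} makes both coordinates odd,
-- and the result is (1+i) u for some u ∈ S_m, so induction puts it in B_(m+1). Prepending two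
-- zero digits multiplies by 2 up to the unit i, giving 2^j S_(n-2j) ⊆ B_n. The union is disjoint
-- because j is the 2-adic valuation of 2^j s for primitive s.

module Submission where

open import Defs
open import Data.Nat using (ℕ; zero; suc; _+_; _*_; _^_; _≤_; _<_; _∸_; z≤n; s≤s)
open import Data.Nat.Properties
open import Data.Nat.DivMod using (_/_; _%_; m/n≡1+[m∸n]/n; [m+n]%n≡m%n; m/n*n≤m; m*n/n≡m; /-monoˡ-≤)
import Data.Nat.Divisibility as ℕ
import Data.Nat.Tactic.RingSolver as ℕ-Ring
open import Data.Integer as ℤ using (ℤ; +_; -[1+_]; ∣_∣)
import Data.Integer.Properties as ℤ
import Data.Integer.Divisibility.Signed as Signed
open import Data.Integer.Divisibility using (_∣_)
open import Data.Integer.GCD using (gcd-greatest; gcd[i,j]∣i; gcd[i,j]∣j)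
import Data.Integer.Tactic.RingSolver as ℤ-Ring
open import Data.Fin as Fin using (Fin; toℕ)
open import Data.Product using (_×_; ∃-syntax; _,_; proj₁)
open import Data.Sum using (inj₁; inj₂)
open import Data.Empty using (⊥-elim)
open import Function using (_∘_)
open import Relation.Binary.PropositionalEquality
open import Relation.Nullary using (¬_; Dec; yes; no)
open import Relation.Nullary.Decidable using (_×-dec_; _→-dec_; map′; from-yes)

w-suc-suc : ∀ n → w (2 + n) ≡ 2 * w n
w-suc-suc n = begin
  w (2 + n)                       ≡⟨ w≡w′ (2 + n) ⟩
  w′ ((2 + n) % 2) ((2 + n) / 2)  ≡⟨ cong₂ w′ [2+n]%2≡n%2 (m/n≡1+[m∸n]/n {2 + n} {2} (s≤s (s≤s z≤n))) ⟩
  w′ (n % 2) (suc (n / 2))        ≡⟨ w′-suc (n % 2) (n / 2) ⟩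
  2 * w′ (n % 2) (n / 2)          ≡⟨ cong (2 *_) (w≡w′ n) ⟨
  2 * w n                         ∎
  where
  open ≡-Reasoning
  w′ : ℕ → ℕ → ℕ
  w′ zero    k = 2 ^ (k + 1) + 2 ^ k
  w′ (suc _) k = 2 ^ (k + 2)

  w≡w′ : ∀ n → w n ≡ w′ (n % 2) (n / 2)
  w≡w′ n with n % 2
  ... | zero  = refl
  ... | suc _ = refl

  w′-suc : ∀ r k → w′ r (suc k) ≡ 2 * w′ r k
  w′-suc zero    k = sym (*-distribˡ-+ 2 (2 ^ (k + 1)) (2 ^ k))
  w′-suc (suc r) k = refl

  [2+n]%2≡n%2 : (2 + n) % 2 ≡ n % 2
  [2+n]%2≡n%2 = trans (cong (_% 2) (+-comm 2 n)) ([m+n]%n≡m%n n 2)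

3≤w : ∀ n → 3 ≤ w n
3≤w zero          = ≤-refl
3≤w (suc zero)    = s≤s (s≤s (s≤s z≤n))
3≤w (suc (suc n)) rewrite w-suc-suc n = ≤-trans (3≤w n) (m≤n*m (w n) 2)

2≤w : ∀ n → 2 ≤ w n
2≤w n = ≤-trans (n≤1+n 2) (3≤w n)

4≤w-suc : ∀ n → 4 ≤ w (suc n)
4≤w-suc zero    = ≤-refl
4≤w-suc (suc n) rewrite w-suc-suc n = *-monoʳ-≤ 2 (2≤w n)

w-suc-even : ∀ n → ∃[ h ] w (suc n) ≡ 2 * h
w-suc-even zero    = 2 , refl
w-suc-even (suc n) = w n , w-suc-suc n

2+w-suc≤w-suc-suc : ∀ n → 2 + w (1 + n) ≤ w (2 + n)
2+w-suc≤w-suc-suc zero          = ≤-refl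
2+w-suc≤w-suc-suc (suc zero)    = ≤-refl
2+w-suc≤w-suc-suc (suc (suc n)) rewrite w-suc-suc (suc n) | w-suc-suc (suc (suc n)) = begin
  2 + 2 * w (suc n)    ≤⟨ +-monoˡ-≤ (2 * w (suc n)) (m≤n+m 2 2) ⟩
  4 + 2 * w (suc n)    ≡⟨ *-distribˡ-+ 2 2 (w (suc n)) ⟨
  2 * (2 + w (suc n))  ≤⟨ *-monoʳ-≤ 2 (2+w-suc≤w-suc-suc n) ⟩
  2 * w (2 + n)        ∎
  where open ≤-Reasoning

3+2x≤w-suc⇒4+2x≤w-suc : ∀ n x → 3 + 2 * x ≤ w (suc n) → 4 + 2 * x ≤ w (suc n)
3+2x≤w-suc⇒4+2x≤w-suc n x 3+2x≤w with w-suc-even n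
... | h , w≡2h rewrite w≡2h =
  subst (_≤ 2 * h) (*-distribˡ-+ 2 2 x) (*-monoʳ-≤ 2 (*-cancelˡ-< 2 (1 + x) h (subst (_≤ 2 * h) (eq x) 3+2x≤w)))
  where
  eq : ∀ x → 3 + 2 * x ≡ suc (2 * (1 + x))
  eq = ℕ-Ring.solve-∀

ℤ[i]-≡ : ∀ {u v : ℤ[i]} → re u ≡ re v → im u ≡ im v → u ≡ v
ℤ[i]-≡ refl refl = refl

_≟ᵍ_ : (u v : ℤ[i]) → Dec (u ≡ v)
u ≟ᵍ v = map′ (λ (p , q) → ℤ[i]-≡ p q) (λ u≡v → cong re u≡v , cong im u≡v) (re u ℤ.≟ re v ×-dec im u ℤ.≟ im v)

mul-i : ℤ[i] → ℤ[i]
mul-i z = (ℤ.- im z) + re z i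

conj : ℤ[i] → ℤ[i]
conj z = re z + (ℤ.- im z) i

mul-i⁴ : ∀ z → mul-i (mul-i (mul-i (mul-i z))) ≡ z
mul-i⁴ z = ℤ[i]-≡ (ℤ.neg-involutive (re z)) (ℤ.neg-involutive (im z))

0ᵍ-+ᵍ : ∀ z → 0ᵍ +ᵍ z ≡ z
0ᵍ-+ᵍ z = ℤ[i]-≡ (ℤ.+-identityˡ (re z)) (ℤ.+-identityˡ (im z))

+ᵍ-0ᵍ : ∀ z → z +ᵍ 0ᵍ ≡ z
+ᵍ-0ᵍ z = ℤ[i]-≡ (ℤ.+-identityʳ (re z)) (ℤ.+-identityʳ (im z))

-- Identities in ℤ[i] are proved coordinatewise: the ring solver does not unfold the operations of ℤ[i],
-- so each coordinate equation is stated in its unfolded form.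
*ᵍ-1ᵍ : ∀ z → z *ᵍ (ω ^ᵍ 0) ≡ z
*ᵍ-1ᵍ (a + b i) = ℤ[i]-≡ (l₁ a b) (l₂ a b)
  where
  l₁ : ∀ a b → a ℤ.* + 1 ℤ.- b ℤ.* + 0 ≡ a
  l₁ = ℤ-Ring.solve-∀
  l₂ : ∀ a b → a ℤ.* + 0 ℤ.+ b ℤ.* + 1 ≡ b
  l₂ = ℤ-Ring.solve-∀

*ᵍ-0ᵍ : ∀ z → z *ᵍ 0ᵍ ≡ 0ᵍ
*ᵍ-0ᵍ (a + b i) = ℤ[i]-≡ (l₁ a b) (l₂ a b)
  where
  l₁ : ∀ a b → a ℤ.* + 0 ℤ.- b ℤ.* + 0 ≡ + 0
  l₁ = ℤ-Ring.solve-∀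
  l₂ : ∀ a b → a ℤ.* + 0 ℤ.+ b ℤ.* + 0 ≡ + 0
  l₂ = ℤ-Ring.solve-∀

*ᵍ-+ᵍ-factor : ∀ c x y s → (x *ᵍ (c *ᵍ y)) +ᵍ (c *ᵍ s) ≡ c *ᵍ ((x *ᵍ y) +ᵍ s)
*ᵍ-+ᵍ-factor (e + f i) (a + b i) (p + q i) (g + h i) = ℤ[i]-≡ (l₁ a b e f g h p q) (l₂ a b e f g h p q)
  where
  l₁ : ∀ a b e f g h p q →
    a ℤ.* (e ℤ.* p ℤ.- f ℤ.* q) ℤ.- b ℤ.* (e ℤ.* q ℤ.+ f ℤ.* p) ℤ.+ (e ℤ.* g ℤ.- f ℤ.* h)
      ≡ e ℤ.* (a ℤ.* p ℤ.- b ℤ.* q ℤ.+ g) ℤ.- f ℤ.* (a ℤ.* q ℤ.+ b ℤ.* p ℤ.+ h)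
  l₁ = ℤ-Ring.solve-∀
  l₂ : ∀ a b e f g h p q →
    a ℤ.* (e ℤ.* q ℤ.+ f ℤ.* p) ℤ.+ b ℤ.* (e ℤ.* p ℤ.- f ℤ.* q) ℤ.+ (e ℤ.* h ℤ.+ f ℤ.* g)
      ≡ e ℤ.* (a ℤ.* q ℤ.+ b ℤ.* p ℤ.+ h) ℤ.+ f ℤ.* (a ℤ.* p ℤ.- b ℤ.* q ℤ.+ g)
  l₂ = ℤ-Ring.solve-∀

mul-i-+ᵍ-*ᵍ : ∀ a c b → mul-i (a +ᵍ (c *ᵍ b)) ≡ mul-i a +ᵍ (c *ᵍ mul-i b)
mul-i-+ᵍ-*ᵍ (a₁ + a₂ i) (e + f i) (p + q i) = ℤ[i]-≡ (l₁ a₂ e f p q) (l₂ a₁ e f p q)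
  where
  l₁ : ∀ a₂ e f p q → ℤ.- (a₂ ℤ.+ (e ℤ.* q ℤ.+ f ℤ.* p)) ≡ ℤ.- a₂ ℤ.+ (e ℤ.* ℤ.- q ℤ.- f ℤ.* p)
  l₁ = ℤ-Ring.solve-∀
  l₂ : ∀ a₁ e f p q → a₁ ℤ.+ (e ℤ.* p ℤ.- f ℤ.* q) ≡ a₁ ℤ.+ (e ℤ.* p ℤ.+ f ℤ.* ℤ.- q)
  l₂ = ℤ-Ring.solve-∀

-- conj ω = -i · ω
conj-+ᵍ-ω*ᵍ : ∀ a b → conj (a +ᵍ (ω *ᵍ b)) ≡ conj a +ᵍ (ω *ᵍ mul-i (mul-i (mul-i (conj b))))
conj-+ᵍ-ω*ᵍ (a₁ + a₂ i) (p + q i) = ℤ[i]-≡ (l₁ a₁ p q) (l₂ a₂ p q)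
  where
  l₁ : ∀ a₁ p q → a₁ ℤ.+ (+ 1 ℤ.* p ℤ.- + 1 ℤ.* q)
                    ≡ a₁ ℤ.+ (+ 1 ℤ.* ℤ.- ℤ.- ℤ.- q ℤ.- + 1 ℤ.* ℤ.- p)
  l₁ = ℤ-Ring.solve-∀
  l₂ : ∀ a₂ p q → ℤ.- (a₂ ℤ.+ (+ 1 ℤ.* q ℤ.+ + 1 ℤ.* p))
                    ≡ ℤ.- a₂ ℤ.+ (+ 1 ℤ.* ℤ.- p ℤ.+ + 1 ℤ.* ℤ.- ℤ.- ℤ.- q)
  l₂ = ℤ-Ring.solve-∀

-- ω² = 2i
ω-horner² : ∀ a b c → a +ᵍ (ω *ᵍ (b +ᵍ (ω *ᵍ c))) ≡ (a +ᵍ (ω *ᵍ b)) +ᵍ scale2 1 (mul-i c)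
ω-horner² (a₁ + a₂ i) (b₁ + b₂ i) (c₁ + c₂ i) = ℤ[i]-≡ (l₁ a₁ b₁ b₂ c₁ c₂) (l₂ a₂ b₁ b₂ c₁ c₂)
  where
  l₁ : ∀ a₁ b₁ b₂ c₁ c₂ →
    a₁ ℤ.+ (+ 1 ℤ.* (b₁ ℤ.+ (+ 1 ℤ.* c₁ ℤ.- + 1 ℤ.* c₂)) ℤ.- + 1 ℤ.* (b₂ ℤ.+ (+ 1 ℤ.* c₂ ℤ.+ + 1 ℤ.* c₁)))
      ≡ a₁ ℤ.+ (+ 1 ℤ.* b₁ ℤ.- + 1 ℤ.* b₂) ℤ.+ (+ 2 ℤ.* ℤ.- c₂ ℤ.- + 0 ℤ.* c₁)
  l₁ = ℤ-Ring.solve-∀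
  l₂ : ∀ a₂ b₁ b₂ c₁ c₂ →
    a₂ ℤ.+ (+ 1 ℤ.* (b₂ ℤ.+ (+ 1 ℤ.* c₂ ℤ.+ + 1 ℤ.* c₁)) ℤ.+ + 1 ℤ.* (b₁ ℤ.+ (+ 1 ℤ.* c₁ ℤ.- + 1 ℤ.* c₂)))
      ≡ a₂ ℤ.+ (+ 1 ℤ.* b₂ ℤ.+ + 1 ℤ.* b₁) ℤ.+ (+ 2 ℤ.* c₁ ℤ.+ + 0 ℤ.* ℤ.- c₂)
  l₂ = ℤ-Ring.solve-∀

scale2-zero : ∀ s → scale2 0 s ≡ s
scale2-zero (x + y i) = ℤ[i]-≡ (l₁ x y) (l₂ x y)
  where
  l₁ : ∀ x y → + 1 ℤ.* x ℤ.- + 0 ℤ.* y ≡ x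
  l₁ = ℤ-Ring.solve-∀
  l₂ : ∀ x y → + 1 ℤ.* y ℤ.+ + 0 ℤ.* x ≡ y
  l₂ = ℤ-Ring.solve-∀

scale2-suc : ∀ j s → scale2 1 (scale2 j s) ≡ scale2 (suc j) s
scale2-suc j (x + y i) =
  ℤ[i]-≡ (trans (l₁ (+ 2 ^ j) x y) (cong (λ k → k ℤ.* x ℤ.- + 0 ℤ.* y) 2*2^j))
         (trans (l₂ (+ 2 ^ j) x y) (cong (λ k → k ℤ.* y ℤ.+ + 0 ℤ.* x) 2*2^j))
  where
  2*2^j : + 2 ℤ.* + 2 ^ j ≡ + (2 ^ suc j)
  2*2^j = sym (ℤ.pos-* 2 (2 ^ j))
  l₁ : ∀ k x y → + 2 ℤ.* (k ℤ.* x ℤ.- + 0 ℤ.* y) ℤ.- + 0 ℤ.* (k ℤ.* y ℤ.+ + 0 ℤ.* x) ≡ + 2 ℤ.* k ℤ.* x ℤ.- + 0 ℤ.* y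
  l₁ = ℤ-Ring.solve-∀
  l₂ : ∀ k x y → + 2 ℤ.* (k ℤ.* y ℤ.+ + 0 ℤ.* x) ℤ.+ + 0 ℤ.* (k ℤ.* x ℤ.- + 0 ℤ.* y) ≡ + 2 ℤ.* k ℤ.* y ℤ.+ + 0 ℤ.* x
  l₂ = ℤ-Ring.solve-∀

∣re-scale2∣ : ∀ j s → ∣ re (scale2 j s) ∣ ≡ 2 ^ j * ∣ re s ∣
∣re-scale2∣ j (x + y i) = trans (cong ∣_∣ (l (+ 2 ^ j) x y)) (ℤ.abs-* (+ 2 ^ j) x)
  where
  l : ∀ k x y → k ℤ.* x ℤ.- + 0 ℤ.* y ≡ k ℤ.* x
  l = ℤ-Ring.solve-∀

∣im-scale2∣ : ∀ j s → ∣ im (scale2 j s) ∣ ≡ 2 ^ j * ∣ im s ∣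
∣im-scale2∣ j (x + y i) = trans (cong ∣_∣ (l (+ 2 ^ j) x y)) (ℤ.abs-* (+ 2 ^ j) y)
  where
  l : ∀ k x y → k ℤ.* y ℤ.+ + 0 ℤ.* x ≡ k ℤ.* y
  l = ℤ-Ring.solve-∀

-- Horner expansions: the elements of B_n

data Expansion : ℕ → ℤ[i] → Set where
  [_] : ∀ d → Expansion 0 (digit d)
  _∷_ : ∀ {n b} d → Expansion n b → Expansion (suc n) (digit d +ᵍ (ω *ᵍ b))

expansion : ∀ n → (Fin (suc n) → Digit) → ℤ[i]
expansion n v = sumᵍ (suc n) (λ j → digit (v j) *ᵍ (ω ^ᵍ toℕ j))

sumᵍ-*ˡ : ∀ c m (f g : Fin m → ℤ[i]) → sumᵍ m (λ j → f j *ᵍ (c *ᵍ g j)) ≡ c *ᵍ sumᵍ m (λ j → f j *ᵍ g j)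
sumᵍ-*ˡ c zero    f g = sym (*ᵍ-0ᵍ c)
sumᵍ-*ˡ c (suc m) f g = trans (cong ((f Fin.zero *ᵍ (c *ᵍ g Fin.zero)) +ᵍ_) (sumᵍ-*ˡ c m (f ∘ Fin.suc) (g ∘ Fin.suc)))
                              (*ᵍ-+ᵍ-factor c (f Fin.zero) (g Fin.zero) _)

expansion-zero : ∀ v → expansion 0 v ≡ digit (v Fin.zero)
expansion-zero v = trans (+ᵍ-0ᵍ _) (*ᵍ-1ᵍ (digit (v Fin.zero)))

expansion-suc : ∀ n v → expansion (suc n) v ≡ digit (v Fin.zero) +ᵍ (ω *ᵍ expansion n (v ∘ Fin.suc))
expansion-suc n v = cong₂ _+ᵍ_ (*ᵍ-1ᵍ (digit (v Fin.zero)))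
  (sumᵍ-*ˡ ω (suc n) (λ j → digit (v (Fin.suc j))) (λ j → ω ^ᵍ toℕ j))

InB⇒Expansion : ∀ n {z} → InB n z → Expansion n z
InB⇒Expansion zero    (v , refl) = subst (Expansion 0) (sym (expansion-zero v)) [ v Fin.zero ]
InB⇒Expansion (suc n) (v , refl) = subst (Expansion (suc n)) (sym (expansion-suc n v))
  (v Fin.zero ∷ InB⇒Expansion n (v ∘ Fin.suc , refl))

Expansion⇒InB : ∀ {n z} → Expansion n z → InB n z
Expansion⇒InB [ d ] = (λ _ → d) , sym (expansion-zero (λ _ → d))
Expansion⇒InB (d ∷ p) with Expansion⇒InB p
... | v , refl = cons , sym (expansion-suc _ cons)
  where
  cons : Fin (suc (suc _)) → Digit
  cons Fin.zero    = d
  cons (Fin.suc j) = v j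

mul-i-digit : Digit → Digit
mul-i-digit d0  = d0
mul-i-digit d1  = di
mul-i-digit di  = d-1
mul-i-digit d-1 = d-i
mul-i-digit d-i = d1

conj-digit : Digit → Digit
conj-digit d0  = d0
conj-digit d1  = d1
conj-digit di  = d-i
conj-digit d-1 = d-1
conj-digit d-i = di

digit-mul-i : ∀ d → digit (mul-i-digit d) ≡ mul-i (digit d)
digit-mul-i d0  = refl
digit-mul-i d1  = refl
digit-mul-i di  = refl
digit-mul-i d-1 = refl
digit-mul-i d-i = refl

digit-conj : ∀ d → digit (conj-digit d) ≡ conj (digit d)
digit-conj d0  = refl
digit-conj d1  = refl
digit-conj di  = refl
digit-conj d-1 = refl
digit-conj d-i = refl

Expansion-mul-i : ∀ {n z} → Expansion n z → Expansion n (mul-i z)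
Expansion-mul-i [ d ]             = subst (Expansion 0) (digit-mul-i d) [ mul-i-digit d ]
Expansion-mul-i (_∷_ {b = b} d p) = subst (Expansion _)
  (trans (cong (_+ᵍ (ω *ᵍ mul-i b)) (digit-mul-i d)) (sym (mul-i-+ᵍ-*ᵍ (digit d) ω b)))
  (mul-i-digit d ∷ Expansion-mul-i p)

Expansion-conj : ∀ {n z} → Expansion n z → Expansion n (conj z)
Expansion-conj [ d ]             = subst (Expansion 0) (digit-conj d) [ conj-digit d ]
Expansion-conj (_∷_ {b = b} d p) = subst (Expansion _)
  (trans (cong (_+ᵍ (ω *ᵍ mul-i (mul-i (mul-i (conj b))))) (digit-conj d)) (sym (conj-+ᵍ-ω*ᵍ (digit d) b)))
  (conj-digit d ∷ Expansion-mul-i (Expansion-mul-i (Expansion-mul-i (Expansion-conj p))))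

-- S_n with its bounds moved to ℕ

Even : ℤ[i] → Set
Even z = (+ 2 ∣ re z) × (+ 2 ∣ im z)

-- The divisibility of Data.Integer.Divisibility is that of absolute values in ℕ.
Even? : ∀ z → Dec (Even z)
Even? z = (2 ℕ.∣? ∣ re z ∣) ×-dec (2 ℕ.∣? ∣ im z ∣)

Primitive : ℤ[i] → Set
Primitive z = ¬ Even z

Box : ℕ → ℤ[i] → Set
Box n z = 2 + ∣ re z ∣ ≤ w n × 2 + ∣ im z ∣ ≤ w n × 3 + (∣ re z ∣ + ∣ im z ∣) ≤ w (suc n)

InS′ : ℕ → ℤ[i] → Set
InS′ n z = Primitive z × Box n z

+a≤+m-+c⇒c+a≤m : ∀ {a m c} → c ≤ m → + a ℤ.≤ + m ℤ.- + c → c + a ≤ m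
+a≤+m-+c⇒c+a≤m {a} {m} {c} c≤m a≤m-c rewrite ℤ.[+m]-[+n]≡m⊖n m c | ℤ.⊖-≥ c≤m =
  subst (_≤ m) (+-comm a c) (m≤o∸n⇒m+n≤o a c≤m (ℤ.drop‿+≤+ a≤m-c))

c+a≤m⇒+a≤+m-+c : ∀ {a m c} → c ≤ m → c + a ≤ m → + a ℤ.≤ + m ℤ.- + c
c+a≤m⇒+a≤+m-+c {a} {m} {c} c≤m c+a≤m rewrite ℤ.[+m]-[+n]≡m⊖n m c | ℤ.⊖-≥ c≤m =
  ℤ.+≤+ (m+n≤o⇒m≤o∸n a (subst (_≤ m) (+-comm c a) c+a≤m))

InS⇒InS′ : ∀ n {z} → InS n z → InS′ n z
InS⇒InS′ n {z} (_ , 2∤gcd , re≤ , im≤ , re+im≤) =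
  (λ (2∣re , 2∣im) → 2∤gcd (gcd-greatest {re z} {im z} {+ 2} 2∣re 2∣im)) ,
  +a≤+m-+c⇒c+a≤m (2≤w n) re≤ , +a≤+m-+c⇒c+a≤m (2≤w n) im≤ , +a≤+m-+c⇒c+a≤m (3≤w (suc n)) re+im≤

InS′⇒InS : ∀ n {z} → InS′ n z → InS n z
InS′⇒InS n {z} (prim , re≤ , im≤ , re+im≤) =
  (λ { refl → prim (ℕ.divides 0 refl , ℕ.divides 0 refl) }) ,
  (λ 2∣gcd → prim (ℕ.∣-trans 2∣gcd (gcd[i,j]∣i (re z) (im z)) , ℕ.∣-trans 2∣gcd (gcd[i,j]∣j (re z) (im z)))) ,
  c+a≤m⇒+a≤+m-+c (2≤w n) re≤ , c+a≤m⇒+a≤+m-+c (2≤w n) im≤ , c+a≤m⇒+a≤+m-+c (3≤w (suc n)) re+im≤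

-- B_n ∖ {0} ⊆ ⋃ 2^j S_(n-2j)

∀-digit? : {P : Digit → Set} → (∀ d → Dec (P d)) → Dec (∀ d → P d)
∀-digit? P? =
  map′ (λ (p₀ , p₁ , p₋₁ , pᵢ , p₋ᵢ) → λ { d0 → p₀ ; d1 → p₁ ; d-1 → p₋₁ ; di → pᵢ ; d-i → p₋ᵢ })
       (λ p → p d0 , p d1 , p d-1 , p di , p d-i)
       (P? d0 ×-dec P? d1 ×-dec P? d-1 ×-dec P? di ×-dec P? d-i)

Box? : ∀ n z → Dec (Box n z)
Box? n z = (2 + ∣ re z ∣ ≤? w n) ×-dec (2 + ∣ im z ∣ ≤? w n) ×-dec (3 + (∣ re z ∣ + ∣ im z ∣) ≤? w (suc n))

two-digits : Digit → Digit → ℤ[i]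
two-digits d d′ = digit d +ᵍ (ω *ᵍ digit d′)

box-digit : ∀ d → Box 0 (digit d)
box-digit = from-yes (∀-digit? λ d → Box? 0 (digit d))

box-two-digits : ∀ d d′ → Box 1 (two-digits d d′)
box-two-digits = from-yes (∀-digit? λ d → ∀-digit? λ d′ → Box? 1 (two-digits d d′))

even-digit⇒0 : ∀ d → Even (digit d) → digit d ≡ 0ᵍ
even-digit⇒0 = from-yes (∀-digit? λ d → Even? (digit d) →-dec (digit d ≟ᵍ 0ᵍ))

even-two-digits⇒0 : ∀ d d′ → Even (two-digits d d′) → two-digits d d′ ≡ 0ᵍ
even-two-digits⇒0 = from-yes (∀-digit? λ d → ∀-digit? λ d′ → Even? (two-digits d d′) →-dec (two-digits d d′ ≟ᵍ 0ᵍ))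

doubling-bound : ∀ k {x e q v} → x ≤ e + 2 * q → k + e ≤ 2 * k → k + q ≤ v → k + x ≤ 2 * v
doubling-bound k {x} {e} {q} {v} x≤e+2q k+e≤2k k+q≤v = begin
  k + x            ≤⟨ +-monoʳ-≤ k x≤e+2q ⟩
  k + (e + 2 * q)  ≡⟨ +-assoc k e (2 * q) ⟨
  k + e + 2 * q    ≤⟨ +-monoˡ-≤ (2 * q) k+e≤2k ⟩
  2 * k + 2 * q    ≡⟨ *-distribˡ-+ 2 k q ⟨
  2 * (k + q)      ≤⟨ *-monoʳ-≤ 2 k+q≤v ⟩
  2 * v            ∎
  where open ≤-Reasoning

∣re-+ᵍ-2i*∣ : ∀ e c → ∣ re (e +ᵍ scale2 1 (mul-i c)) ∣ ≤ ∣ re e ∣ + 2 * ∣ im c ∣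
∣re-+ᵍ-2i*∣ e c = begin
  ∣ re (e +ᵍ scale2 1 (mul-i c)) ∣              ≤⟨ ℤ.∣i+j∣≤∣i∣+∣j∣ (re e) _ ⟩
  ∣ re e ∣ + ∣ re (scale2 1 (mul-i c)) ∣        ≡⟨ cong (_+_ ∣ re e ∣) (∣re-scale2∣ 1 (mul-i c)) ⟩
  ∣ re e ∣ + 2 * ∣ ℤ.- im c ∣                   ≡⟨ cong (λ k → ∣ re e ∣ + 2 * k) (ℤ.∣-i∣≡∣i∣ (im c)) ⟩
  ∣ re e ∣ + 2 * ∣ im c ∣                       ∎
  where open ≤-Reasoning

∣im-+ᵍ-2i*∣ : ∀ e c → ∣ im (e +ᵍ scale2 1 (mul-i c)) ∣ ≤ ∣ im e ∣ + 2 * ∣ re c ∣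
∣im-+ᵍ-2i*∣ e c = begin
  ∣ im (e +ᵍ scale2 1 (mul-i c)) ∣              ≤⟨ ℤ.∣i+j∣≤∣i∣+∣j∣ (im e) _ ⟩
  ∣ im e ∣ + ∣ im (scale2 1 (mul-i c)) ∣        ≡⟨ cong (_+_ ∣ im e ∣) (∣im-scale2∣ 1 (mul-i c)) ⟩
  ∣ im e ∣ + 2 * ∣ re c ∣                       ∎
  where open ≤-Reasoning

box-+ᵍ-2i* : ∀ n {e c} → Box 1 e → Box n c → Box (2 + n) (e +ᵍ scale2 1 (mul-i c))
box-+ᵍ-2i* n {e} {c} (e-re , e-im , e-re+im) (c-re , c-im , c-re+im) =
  subst (2 + ∣ re z ∣ ≤_) (sym (w-suc-suc n)) (doubling-bound 2 (∣re-+ᵍ-2i*∣ e c) e-re c-im) ,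
  subst (2 + ∣ im z ∣ ≤_) (sym (w-suc-suc n)) (doubling-bound 2 (∣im-+ᵍ-2i*∣ e c) e-im c-re) ,
  subst (3 + (∣ re z ∣ + ∣ im z ∣) ≤_) (sym (w-suc-suc (suc n))) (doubling-bound 3 re+im≤ e-re+im c-re+im)
  where
  z = e +ᵍ scale2 1 (mul-i c)
  regroup : ∀ a b p q → (a + 2 * q) + (b + 2 * p) ≡ (a + b) + 2 * (p + q)
  regroup = ℕ-Ring.solve-∀
  re+im≤ : ∣ re z ∣ + ∣ im z ∣ ≤ (∣ re e ∣ + ∣ im e ∣) + 2 * (∣ re c ∣ + ∣ im c ∣)
  re+im≤ = ≤-trans (+-mono-≤ (∣re-+ᵍ-2i*∣ e c) (∣im-+ᵍ-2i*∣ e c))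
                   (≤-reflexive (regroup (∣ re e ∣) (∣ im e ∣) (∣ re c ∣) (∣ im c ∣)))

Expansion⇒Box : ∀ {n z} → Expansion n z → Box n z
Expansion⇒Box [ d ]            = box-digit d
Expansion⇒Box (d ∷ [ d′ ])     = box-two-digits d d′
Expansion⇒Box {suc (suc n)} (d ∷ (_∷_ {b = c} d′ p)) =
  subst (Box (2 + n)) (sym (ω-horner² (digit d) (digit d′) c))
    (box-+ᵍ-2i* n {two-digits d d′} {c} (box-two-digits d d′) (Expansion⇒Box p))

∣m+n∣n⇒∣m : ∀ k m n → k ∣ m ℤ.+ n → k ∣ n → k ∣ m
∣m+n∣n⇒∣m k m n k∣m+n k∣n =
  Signed.∣⇒∣ᵤ {k} {m} (Signed.∣m+n∣n⇒∣m (Signed.∣ᵤ⇒∣ {k} {m ℤ.+ n} k∣m+n) (Signed.∣ᵤ⇒∣ {k} {n} k∣n))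

even-+ᵍ-even : ∀ u v → Even (u +ᵍ v) → Even v → Even u
even-+ᵍ-even u v (2∣re , 2∣im) (2∣re′ , 2∣im′) =
  ∣m+n∣n⇒∣m (+ 2) (re u) (re v) 2∣re 2∣re′ , ∣m+n∣n⇒∣m (+ 2) (im u) (im v) 2∣im 2∣im′

even-scale2-suc : ∀ j s → Even (scale2 (suc j) s)
even-scale2-suc j s = ℕ.divides (2 ^ j * ∣ re s ∣) (trans (∣re-scale2∣ (suc j) s) (double (2 ^ j) (∣ re s ∣))) ,
                      ℕ.divides (2 ^ j * ∣ im s ∣) (trans (∣im-scale2∣ (suc j) s) (double (2 ^ j) (∣ im s ∣)))
  where
  double : ∀ p x → 2 * p * x ≡ p * x * 2
  double p x = trans (*-assoc 2 p x) (*-comm 2 (p * x))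

even-horner²⇒2i* : ∀ d d′ c → Even (digit d +ᵍ (ω *ᵍ (digit d′ +ᵍ (ω *ᵍ c)))) →
                   digit d +ᵍ (ω *ᵍ (digit d′ +ᵍ (ω *ᵍ c))) ≡ scale2 1 (mul-i c)
even-horner²⇒2i* d d′ c even = begin
  digit d +ᵍ (ω *ᵍ (digit d′ +ᵍ (ω *ᵍ c)))  ≡⟨ ω-horner² (digit d) (digit d′) c ⟩
  two-digits d d′ +ᵍ scale2 1 (mul-i c)       ≡⟨ cong (_+ᵍ scale2 1 (mul-i c)) two-digits≡0 ⟩
  0ᵍ +ᵍ scale2 1 (mul-i c)                    ≡⟨ 0ᵍ-+ᵍ (scale2 1 (mul-i c)) ⟩
  scale2 1 (mul-i c)                          ∎
  where
  open ≡-Reasoning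
  two-digits≡0 : two-digits d d′ ≡ 0ᵍ
  two-digits≡0 = even-two-digits⇒0 d d′
    (even-+ᵍ-even (two-digits d d′) (scale2 1 (mul-i c))
      (subst Even (ω-horner² (digit d) (digit d′) c) even) (even-scale2-suc 0 (mul-i c)))

Decomposition : ℕ → ℤ[i] → Set
Decomposition n z = ∃[ j ] ∃[ m ] n ≡ 2 * j + m × ∃[ s ] InS′ m s × z ≡ scale2 j s

mutual
  decompose : ∀ n {z} → Expansion n z → ¬ z ≡ 0ᵍ → Decomposition n z
  decompose n {z} p z≢0 with Even? z
  ... | no  ¬even = 0 , n , refl , z , (¬even , Expansion⇒Box p) , sym (scale2-zero z)
  ... | yes even  = decompose-even n p z≢0 even

  decompose-even : ∀ n {z} → Expansion n z → ¬ z ≡ 0ᵍ → Even z → Decomposition n z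
  decompose-even zero       [ d ]        z≢0 even = ⊥-elim (z≢0 (even-digit⇒0 d even))
  decompose-even (suc zero) (d ∷ [ d′ ]) z≢0 even = ⊥-elim (z≢0 (even-two-digits⇒0 d d′ even))
  decompose-even (suc (suc n)) (d ∷ (_∷_ {b = c} d′ p)) z≢0 even =
    halve-decomposition (decompose n (Expansion-mul-i p) (λ ic≡0 → z≢0 (trans z≡2ic (cong (scale2 1) ic≡0))))
    where
    z≡2ic = even-horner²⇒2i* d d′ c even
    halve-decomposition : Decomposition n (mul-i c) → Decomposition (2 + n) (digit d +ᵍ (ω *ᵍ (digit d′ +ᵍ (ω *ᵍ c))))
    halve-decomposition (j , m , n≡2j+m , s , s∈S , ic≡2ʲs) =
      suc j , m , trans (cong (_+_ 2) n≡2j+m) (cong (_+ m) (sym (*-suc 2 j))) , s , s∈S ,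
      trans z≡2ic (trans (cong (scale2 1) ic≡2ʲs) (scale2-suc j s))

-- S_n ⊆ B_n

Expansion-from-abs : ∀ {n} (x y : ℤ) → Expansion n ((+ ∣ x ∣) + (+ ∣ y ∣) i) → Expansion n (x + y i)
Expansion-from-abs {n} x y = fix-re x y ∘ fix-im (+ ∣ x ∣) y
  where
  fix-im : ∀ x y → Expansion n (x + (+ ∣ y ∣) i) → Expansion n (x + y i)
  fix-im x (+ k)    p = p
  fix-im x -[1+ k ] p = Expansion-conj p
  fix-re : ∀ x y → Expansion n ((+ ∣ x ∣) + y i) → Expansion n (x + y i)
  fix-re (+ k)    y p = p
  fix-re -[1+ k ] y p = subst (λ t → Expansion n (-[1+ k ] + t i)) (ℤ.neg-involutive y)
    (Expansion-mul-i (Expansion-mul-i (Expansion-conj p)))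

Expansion-swap : ∀ {n} a c → Expansion n ((+ c) + (+ a) i) → Expansion n ((+ a) + (+ c) i)
Expansion-swap {n} a c p = subst (λ t → Expansion n (t + (+ c) i)) (ℤ.neg-involutive (+ a)) (Expansion-mul-i (Expansion-conj p))

Box-swap : ∀ {n} a c → Box n ((+ a) + (+ c) i) → Box n ((+ c) + (+ a) i)
Box-swap {n} a c (a≤ , c≤ , a+c≤) = c≤ , a≤ , subst (λ k → 3 + k ≤ w (suc n)) (+-comm a c) a+c≤

InS′-conj : ∀ n u → InS′ n u → InS′ n (conj u)
InS′-conj n u = subst InS′-with-∣im∣ (sym (ℤ.∣-i∣≡∣i∣ (im u)))
  where
  InS′-with-∣im∣ : ℕ → Set
  InS′-with-∣im∣ k = ¬ (2 ℕ.∣ ∣ re u ∣ × 2 ℕ.∣ k) × 2 + ∣ re u ∣ ≤ w n × 2 + k ≤ w n × 3 + (∣ re u ∣ + k) ≤ w (suc n)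

ω*ᵍ-conj : ∀ u → ω *ᵍ conj u ≡ mul-i (conj (ω *ᵍ u))
ω*ᵍ-conj (x + y i) = ℤ[i]-≡ (l₁ x y) (l₂ x y)
  where
  l₁ : ∀ x y → + 1 ℤ.* x ℤ.- + 1 ℤ.* ℤ.- y ≡ ℤ.- ℤ.- (+ 1 ℤ.* y ℤ.+ + 1 ℤ.* x)
  l₁ = ℤ-Ring.solve-∀
  l₂ : ∀ x y → + 1 ℤ.* ℤ.- y ℤ.+ + 1 ℤ.* x ≡ + 1 ℤ.* x ℤ.- + 1 ℤ.* y
  l₂ = ℤ-Ring.solve-∀

2∤1+2*k : ∀ k → ¬ 2 ℕ.∣ 1 + 2 * k
2∤1+2*k k 2∣1+2k with ℕ.∣⇒≤ (ℕ.∣m+n∣m⇒∣n (subst (2 ℕ.∣_) (+-comm 1 (2 * k)) 2∣1+2k) (ℕ.m∣m*n k))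
... | s≤s ()

oddᵍ : ℕ → ℕ → ℤ[i]
oddᵍ α γ = (+ (1 + 2 * α)) + (+ (1 + 2 * γ)) i

ω-quotient-≤ : ∀ n α δ → 3 + (α + (α + δ)) ≤ w n → 4 + 2 * (α + δ) ≤ w (suc n) →
               ∃[ u ] InS′ n u × ω *ᵍ u ≡ oddᵍ α (α + δ)
ω-quotient-≤ n α δ h₁ h₂ = u , (u-primitive , re≤ , im≤ , re+im≤) , ℤ[i]-≡ (l₁ (+ α) (+ δ)) (l₂ (+ α) (+ δ))
  where
  u = (+ (1 + 2 * α + δ)) + (+ δ) i
  l₁ : ∀ A D → + 1 ℤ.* (+ 1 ℤ.+ (A ℤ.+ (A ℤ.+ + 0)) ℤ.+ D) ℤ.- + 1 ℤ.* D ≡ + 1 ℤ.+ (A ℤ.+ (A ℤ.+ + 0))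
  l₁ = ℤ-Ring.solve-∀
  l₂ : ∀ A D → + 1 ℤ.* D ℤ.+ + 1 ℤ.* (+ 1 ℤ.+ (A ℤ.+ (A ℤ.+ + 0)) ℤ.+ D)
               ≡ + 1 ℤ.+ ((A ℤ.+ D) ℤ.+ ((A ℤ.+ D) ℤ.+ + 0))
  l₂ = ℤ-Ring.solve-∀
  u-primitive : Primitive u
  u-primitive (2∣re , 2∣im) = 2∤1+2*k α (ℕ.∣m+n∣m⇒∣n (subst (2 ℕ.∣_) (+-comm (1 + 2 * α) δ) 2∣re) 2∣im)
  eq₁ : ∀ α δ → 3 + (α + (α + δ)) ≡ 2 + (1 + 2 * α + δ)
  eq₁ = ℕ-Ring.solve-∀
  re≤ : 2 + (1 + 2 * α + δ) ≤ w n
  re≤ = subst (_≤ w n) (eq₁ α δ) h₁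
  im≤ : 2 + δ ≤ w n
  im≤ = ≤-trans (+-monoʳ-≤ 2 (m≤n+m δ (1 + 2 * α))) re≤
  eq₃ : ∀ α δ → 4 + 2 * (α + δ) ≡ 3 + ((1 + 2 * α + δ) + δ)
  eq₃ = ℕ-Ring.solve-∀
  re+im≤ : 3 + ((1 + 2 * α + δ) + δ) ≤ w (suc n)
  re+im≤ = subst (_≤ w (suc n)) (eq₃ α δ) h₂

ω-quotient : ∀ n α γ → 3 + (α + γ) ≤ w n → 4 + 2 * α ≤ w (suc n) → 4 + 2 * γ ≤ w (suc n) →
             ∃[ u ] InS′ n u × ω *ᵍ u ≡ oddᵍ α γ
ω-quotient n α γ h₁ h₂ h₃ with ≤-total α γ
... | inj₁ α≤γ with δ , refl ← m≤n⇒∃[o]m+o≡n α≤γ = ω-quotient-≤ n α δ h₁ h₃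
... | inj₂ γ≤α with δ , refl ← m≤n⇒∃[o]m+o≡n γ≤α
  with u , u∈S , ωu≡ ← ω-quotient-≤ n γ δ (subst (λ k → 3 + k ≤ w n) (+-comm (γ + δ) γ) h₁) h₂ =
  conj u , InS′-conj n u u∈S , trans (ω*ᵍ-conj u) (cong (mul-i ∘ conj) ωu≡)

data Parity : ℕ → Set where
  even : ∀ k → Parity (2 * k)
  odd  : ∀ k → Parity (1 + 2 * k)

parity : ∀ n → Parity n
parity zero = even 0
parity (suc n) with parity n
... | even k = odd k
... | odd k  = subst Parity (*-suc 2 k) (even (suc k))

1+2x≤w[2+n]⇒x<w[n] : ∀ n x → 1 + 2 * x ≤ w (2 + n) → x < w n
1+2x≤w[2+n]⇒x<w[n] n x h = *-cancelˡ-< 2 x (w n) (subst (1 + 2 * x ≤_) (w-suc-suc n) h)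

-- The digit d ∈ {0, ±i} is chosen to make the imaginary part odd; the bounds are those ω-quotient needs.
odd-re-step : ∀ n α c → Box (suc n) ((+ (1 + 2 * α)) + (+ c) i) →
  ∃[ d ] ∃[ γ ] digit d +ᵍ oddᵍ α γ ≡ (+ (1 + 2 * α)) + (+ c) i
              × 3 + (α + γ) ≤ w n × 4 + 2 * α ≤ w (suc n) × 4 + 2 * γ ≤ w (suc n)
odd-re-step n α c (re≤ , im≤ , re+im≤) with parity c
... | odd γ =
  d0 , γ , 0ᵍ-+ᵍ (oddᵍ α γ) ,
  1+2x≤w[2+n]⇒x<w[n] n (2 + (α + γ)) (subst (_≤ w (2 + n)) (eq α γ) re+im≤) ,
  3+2x≤w-suc⇒4+2x≤w-suc n α re≤ , 3+2x≤w-suc⇒4+2x≤w-suc n γ im≤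
  where
  eq : ∀ α γ → 3 + ((1 + 2 * α) + (1 + 2 * γ)) ≡ 1 + 2 * (2 + (α + γ))
  eq = ℕ-Ring.solve-∀
... | even zero =
  d-i , 0 , refl ,
  1+2x≤w[2+n]⇒x<w[n] n (2 + (α + 0))
    (≤-trans (≤-reflexive (eq α)) (≤-trans (+-monoʳ-≤ 2 re≤) (2+w-suc≤w-suc-suc n))) ,
  3+2x≤w-suc⇒4+2x≤w-suc n α re≤ , 4≤w-suc n
  where
  eq : ∀ α → 1 + 2 * (2 + (α + 0)) ≡ 2 + (2 + (1 + 2 * α))
  eq = ℕ-Ring.solve-∀
... | even (suc γ) =
  di , γ , cong (λ k → (+ (1 + 2 * α)) + (+ k) i) (sym (*-suc 2 γ)) ,
  1+2x≤w[2+n]⇒x<w[n] n (2 + (α + γ)) (≤-trans (n≤1+n _) (subst (_≤ w (2 + n)) (eq₁ α γ) re+im≤)) ,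
  3+2x≤w-suc⇒4+2x≤w-suc n α re≤ , subst (_≤ w (suc n)) (eq₂ γ) im≤
  where
  eq₁ : ∀ α γ → 3 + ((1 + 2 * α) + 2 * suc γ) ≡ 2 + 2 * (2 + (α + γ))
  eq₁ = ℕ-Ring.solve-∀
  eq₂ : ∀ γ → 2 + 2 * suc γ ≡ 4 + 2 * γ
  eq₂ = ℕ-Ring.solve-∀

Expansion-odd-re : ∀ n α c → (∀ u → InS′ n u → Expansion n u) →
                   Box (suc n) ((+ (1 + 2 * α)) + (+ c) i) → Expansion (suc n) ((+ (1 + 2 * α)) + (+ c) i)
Expansion-odd-re n α c expand box
  with d , γ , d+oddᵍ≡z , h₁ , h₂ , h₃ ← odd-re-step n α c box
  with u , u∈S , ωu≡oddᵍ ← ω-quotient n α γ h₁ h₂ h₃ =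
  subst (Expansion (suc n)) (trans (cong (digit d +ᵍ_) ωu≡oddᵍ) d+oddᵍ≡z) (d ∷ expand u u∈S)

InS′₀⇒Expansion : ∀ a c → InS′ 0 ((+ a) + (+ c) i) → Expansion 0 ((+ a) + (+ c) i)
InS′₀⇒Expansion 0             0             (prim , _) = ⊥-elim (prim (2 ℕ.∣0 , 2 ℕ.∣0))
InS′₀⇒Expansion 1             0             _          = [ d1 ]
InS′₀⇒Expansion 0             1             _          = [ di ]
InS′₀⇒Expansion (suc (suc a)) c             (_ , _ , _ , s≤s (s≤s (s≤s (s≤s ()))))
InS′₀⇒Expansion 1             (suc c)       (_ , _ , _ , s≤s (s≤s (s≤s (s≤s ()))))
InS′₀⇒Expansion 0             (suc (suc c)) (_ , _ , _ , s≤s (s≤s (s≤s (s≤s ()))))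

mutual
  InS′⇒Expansion : ∀ n z → InS′ n z → Expansion n z
  InS′⇒Expansion n (x + y i) s = Expansion-from-abs x y (InS′⇒Expansion-ℕ n ∣ x ∣ ∣ y ∣ s)

  InS′⇒Expansion-ℕ : ∀ n a c → InS′ n ((+ a) + (+ c) i) → Expansion n ((+ a) + (+ c) i)
  InS′⇒Expansion-ℕ zero    a c s = InS′₀⇒Expansion a c s
  InS′⇒Expansion-ℕ (suc n) a c (prim , box) with parity a | parity c
  ... | odd α  | _      = Expansion-odd-re n α c (InS′⇒Expansion n) box
  ... | even α | odd γ  = Expansion-swap (2 * α) c
                            (Expansion-odd-re n γ (2 * α) (InS′⇒Expansion n) (Box-swap {suc n} (2 * α) c box))
  ... | even α | even γ = ⊥-elim (prim (ℕ.m∣m*n α , ℕ.m∣m*n γ))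

Expansion-double : ∀ {k t} → Expansion k t → Expansion (2 + k) (scale2 1 t)
Expansion-double {k} {t} p =
  subst (Expansion (2 + k)) eq (d0 ∷ (d0 ∷ Expansion-mul-i (Expansion-mul-i (Expansion-mul-i p))))
  where
  t′ : ℤ[i]
  t′ = mul-i (mul-i (mul-i t))
  eq : digit d0 +ᵍ (ω *ᵍ (digit d0 +ᵍ (ω *ᵍ t′))) ≡ scale2 1 t
  eq = trans (ω-horner² (digit d0) (digit d0) t′) (trans (0ᵍ-+ᵍ (scale2 1 (mul-i t′))) (cong (scale2 1) (mul-i⁴ t)))

Expansion-scale2 : ∀ j {m s} → Expansion m s → Expansion (2 * j + m) (scale2 j s)
Expansion-scale2 zero    {m} {s} p = subst (Expansion m) (sym (scale2-zero s)) p
Expansion-scale2 (suc j) {m} {s} p =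
  subst₂ Expansion (cong (_+ m) (sym (*-suc 2 j))) (scale2-suc j s) (Expansion-double (Expansion-scale2 j p))

2^j*x≡0⇒x≡0 : ∀ j x → 2 ^ j * x ≡ 0 → x ≡ 0
2^j*x≡0⇒x≡0 j x eq = m*n≡0⇒m≡0 x (2 ^ j) {{m^n≢0 2 j}} (trans (*-comm x (2 ^ j)) eq)

scale2-≢0 : ∀ j s → Primitive s → ¬ scale2 j s ≡ 0ᵍ
scale2-≢0 j s prim 2ʲs≡0 = prim (subst (2 ℕ.∣_) (sym ∣re∣≡0) (2 ℕ.∣0) , subst (2 ℕ.∣_) (sym ∣im∣≡0) (2 ℕ.∣0))
  where
  ∣re∣≡0 : ∣ re s ∣ ≡ 0
  ∣re∣≡0 = 2^j*x≡0⇒x≡0 j _ (trans (sym (∣re-scale2∣ j s)) (cong (∣_∣ ∘ re) 2ʲs≡0))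
  ∣im∣≡0 : ∣ im s ∣ ≡ 0
  ∣im∣≡0 = 2^j*x≡0⇒x≡0 j _ (trans (sym (∣im-scale2∣ j s)) (cong (∣_∣ ∘ im) 2ʲs≡0))

2∣2^[1+j]*x : ∀ j x → 2 ℕ.∣ 2 ^ suc j * x
2∣2^[1+j]*x j x = subst (2 ℕ.∣_) (sym (*-assoc 2 (2 ^ j) x)) (ℕ.m∣m*n (2 ^ j * x))

2-adic-exponent-unique : ∀ j j′ {a b a′ b′} → ¬ (2 ℕ.∣ a × 2 ℕ.∣ b) → ¬ (2 ℕ.∣ a′ × 2 ℕ.∣ b′) →
                         2 ^ j * a ≡ 2 ^ j′ * a′ → 2 ^ j * b ≡ 2 ^ j′ * b′ → j ≡ j′
2-adic-exponent-unique zero    zero     _   _    _  _  = refl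
2-adic-exponent-unique zero    (suc j′) {a} {b} {a′} {b′} 2∤ab _ a≡ b≡ =
  ⊥-elim (2∤ab (subst (2 ℕ.∣_) (trans (sym a≡) (*-identityˡ a)) (2∣2^[1+j]*x j′ a′) ,
               subst (2 ℕ.∣_) (trans (sym b≡) (*-identityˡ b)) (2∣2^[1+j]*x j′ b′)))
2-adic-exponent-unique (suc j) zero     2∤ab 2∤a′b′ a≡ b≡ =
  sym (2-adic-exponent-unique zero (suc j) 2∤a′b′ 2∤ab (sym a≡) (sym b≡))
2-adic-exponent-unique (suc j) (suc j′) {a} {b} {a′} {b′} 2∤ab 2∤a′b′ a≡ b≡ =
  cong suc (2-adic-exponent-unique j j′ 2∤ab 2∤a′b′ (halve a a′ a≡) (halve b b′ b≡))
  where
  halve : ∀ x x′ → 2 ^ suc j * x ≡ 2 ^ suc j′ * x′ → 2 ^ j * x ≡ 2 ^ j′ * x′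
  halve x x′ eq = *-cancelˡ-≡ _ _ 2 (trans (sym (*-assoc 2 (2 ^ j) x)) (trans eq (*-assoc 2 (2 ^ j′) x′)))

scale2-exponent-unique : ∀ j j′ {s s′} → Primitive s → Primitive s′ → scale2 j s ≡ scale2 j′ s′ → j ≡ j′
scale2-exponent-unique j j′ {s} {s′} prim prim′ eq = 2-adic-exponent-unique j j′ prim prim′
  (trans (sym (∣re-scale2∣ j s)) (trans (cong (∣_∣ ∘ re) eq) (∣re-scale2∣ j′ s′)))
  (trans (sym (∣im-scale2∣ j s)) (trans (cong (∣_∣ ∘ im) eq) (∣im-scale2∣ j′ s′)))

j≤[2j+m]/2 : ∀ j m → j ≤ (2 * j + m) / 2
j≤[2j+m]/2 j m = subst (_≤ (2 * j + m) / 2) (m*n/n≡m j 2) (/-monoˡ-≤ 2 (≤-trans (≤-reflexive (*-comm j 2)) (m≤m+n (2 * j) m)))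

j≤n/2⇒2j≤n : ∀ {j n} → j ≤ n / 2 → 2 * j ≤ n
j≤n/2⇒2j≤n {j} {n} j≤n/2 = ≤-trans (≤-reflexive (*-comm 2 j)) (≤-trans (*-monoˡ-≤ 2 j≤n/2) (m/n*n≤m n 2))

nonzero-B⇒⋃2ʲS : ∀ n {z} → InB n z → ¬ z ≡ 0ᵍ → ∃[ j ] (j ≤ n / 2 × ∃[ s ] (InS (n ∸ 2 * j) s × z ≡ scale2 j s))
nonzero-B⇒⋃2ʲS n z∈B z≢0 with decompose n (InB⇒Expansion n z∈B) z≢0
... | j , m , refl , s , s∈S , z≡2ʲs =
  j , j≤[2j+m]/2 j m , s , InS′⇒InS (2 * j + m ∸ 2 * j) (subst (λ k → InS′ k s) (sym (m+n∸m≡n (2 * j) m)) s∈S) , z≡2ʲs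

⋃2ʲS⇒nonzero-B : ∀ n {z} → ∃[ j ] (j ≤ n / 2 × ∃[ s ] (InS (n ∸ 2 * j) s × z ≡ scale2 j s)) → InB n z × ¬ z ≡ 0ᵍ
⋃2ʲS⇒nonzero-B n (j , j≤n/2 , s , s∈S , refl) =
  Expansion⇒InB (subst (λ k → Expansion k (scale2 j s)) (m+[n∸m]≡n (j≤n/2⇒2j≤n j≤n/2))
                       (Expansion-scale2 j (InS′⇒Expansion _ s s∈S′))) ,
  scale2-≢0 j s (proj₁ s∈S′)
  where
  s∈S′ = InS⇒InS′ (n ∸ 2 * j) s∈S

theorem2p2 : (n : ℕ) →
    ((z : ℤ[i]) →
      ((InB n z × ¬ (z ≡ 0ᵍ)) →
        ∃[ j ] (j ≤ n / 2 × ∃[ s ] (InS (n ∸ 2 * j) s × z ≡ scale2 j s)))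
      × (∃[ j ] (j ≤ n / 2 × ∃[ s ] (InS (n ∸ 2 * j) s × z ≡ scale2 j s)) →
        (InB n z × ¬ (z ≡ 0ᵍ))))
    × ((j j′ : ℕ) → (s s′ : ℤ[i]) → j ≤ n / 2 → j′ ≤ n / 2 →
        InS (n ∸ 2 * j) s → InS (n ∸ 2 * j′) s′ →
        scale2 j s ≡ scale2 j′ s′ → j ≡ j′)
theorem2p2 n =
  (λ z → (λ (z∈B , z≢0) → nonzero-B⇒⋃2ʲS n z∈B z≢0) , ⋃2ʲS⇒nonzero-B n) ,
  λ j j′ s s′ _ _ s∈S s′∈S → scale2-exponent-unique j j′
    (proj₁ (InS⇒InS′ (n ∸ 2 * j) s∈S)) (proj₁ (InS⇒InS′ (n ∸ 2 * j′) s′∈S))
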